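{- For each positive integer $k$, there is a connected chordal graph $H_k$ such that $\mathrm{mp}(H_k)=9k$ and $\gamma_b(H_k)=10k$.
   Context: All graphs are finite, simple and undirected; $d(u,v)$ is the shortest-path distance and $\mathrm{diam}(G)$ the diameter. A graph is chordal if every cycle on four or more vertices has a chord. For $v\in V(G)$ and integer $r\ge 0$, $N_r[v]=\{u\in V(G): d(u,v)\le r\}$. A broadcast on $G$ is a function $f:V(G)\to\{0,1,\dots,\mathrm{diam}(G)\}$; it is dominating if for every $u\in V(G)$ there is $v\in V(G)$ (possibly $v=u$) with $f(v)>0$ and $d(u,v)\le f(v)$. Its cost is $\sum_{v} f(v)$, and $\gamma_b(G)$ is the minimum cost of a dominating broadcast on $G$. A multipacking of $G$ is a set $M\subseteq V(G)$ such that $|N_r[v]\cap M|\le r$ for every $v\in V(G)$ and every integer $r\ge 1$; $\mathrm{mp}(G)$ is the maximum size of a multipacking of $G$. -}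

module Defs where

open import Data.Nat using (ℕ; zero; suc; _+_; _*_; _∸_; _≤_; _<_)
open import Data.Fin using (Fin; toℕ)
open import Data.Fin.Subset using (Subset; _∈_; _⊆_; ∣_∣)
open import Data.Bool using (Bool; true; false)
open import Data.List using (map; allFin)
open import Data.Nat.ListAction using (sum)
open import Data.Product using (Σ; ∃; ∃-syntax; _×_; _,_; proj₁)
open import Data.Sum using (_⊎_)
open import Relation.Binary.PropositionalEquality using (_≡_; _≢_)
open import Relation.Nullary using (¬_)
open import Function.Definitions using (Injective)

record Graph : Set where
  field
    n     : ℕ
    adj   : Fin n → Fin n → Bool
    sym   : ∀ u v → adj u v ≡ adj v u
    irrefl : ∀ u → adj u u ≡ false
open Graph public

Adj : (G : Graph) → Fin (n G) → Fin (n G) → Set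
Adj G u v = adj G u v ≡ true

-- Reach G r u v  ⇔  there is a walk of length ≤ r from u to v  ⇔  d(u,v) ≤ r.
data Reach (G : Graph) : ℕ → Fin (n G) → Fin (n G) → Set where
  here : ∀ {r u} → Reach G r u u
  step : ∀ {r u w v} → Adj G u w → Reach G r w v → Reach G (suc r) u v

Connected : Graph → Set
Connected G = ∀ u v → ∃[ r ] Reach G r u v

CycNext : (m : ℕ) → Fin m → Fin m → Set
CycNext m i j = (toℕ j ≡ suc (toℕ i)) ⊎ (toℕ i ≡ m ∸ 1 × toℕ j ≡ 0)

record Cycle (G : Graph) (m : ℕ) : Set where
  field
    vert   : Fin m → Fin (n G)
    inj    : Injective _≡_ _≡_ vert
    edges  : ∀ i j → CycNext m i j → Adj G (vert i) (vert j)
open Cycle public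

HasChord : {G : Graph} {m : ℕ} → Cycle G m → Set
HasChord {G} {m} C = ∃[ i ] ∃[ j ]
  (i ≢ j × ¬ CycNext m i j × ¬ CycNext m j i × Adj G (vert C i) (vert C j))

Chordal : Graph → Set
Chordal G = ∀ m → 4 ≤ m → (C : Cycle G m) → HasChord C

-- f v ≤ diam(G) = max_{u,w} d(u,w): some pair u,w has d(u,w) ≥ f v.
LeDiam : (G : Graph) → ℕ → Set
LeDiam G k = ∃[ u ] ∃[ w ] (∀ r → Reach G r u w → k ≤ r)

Broadcast : Graph → Set
Broadcast G = Σ (Fin (n G) → ℕ) λ f → ∀ v → LeDiam G (f v)

Dominating : (G : Graph) → (Fin (n G) → ℕ) → Set
Dominating G f = ∀ u → ∃[ v ] (0 < f v × Reach G (f v) v u)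

cost : (G : Graph) → (Fin (n G) → ℕ) → ℕ
cost G f = sum (map f (allFin (n G)))

BroadcastDomNumber : Graph → ℕ → Set
BroadcastDomNumber G g =
  (Σ (Broadcast G) λ b → Dominating G (proj₁ b) × cost G (proj₁ b) ≡ g) ×
  (∀ (b : Broadcast G) → Dominating G (proj₁ b) → g ≤ cost G (proj₁ b))

-- |N_r[v] ∩ M| ≤ r, expressed as: every subset of N_r[v] ∩ M has size ≤ r.
Multipacking : (G : Graph) → Subset (n G) → Set
Multipacking G M = ∀ v r → 1 ≤ r → (S : Subset (n G)) → S ⊆ M →
  (∀ {u} → u ∈ S → Reach G r v u) → ∣ S ∣ ≤ r

MultipackingNumber : Graph → ℕ → Set
MultipackingNumber G p =
  (Σ (Subset (n G)) λ M → Multipacking G M × ∣ M ∣ ≡ p) ×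
  (∀ M → Multipacking G M → ∣ M ∣ ≤ p)

-- H_k is a chain of k copies of a 36-vertex unit: a spine path on 27 vertices with three triangles
-- hung along it, the end of each spine joined to the start of the next.  It is chordal because it has a
-- perfect elimination order.  Every third spine vertex gives a multipacking of size 9k, and broadcasting
-- 2 from three vertices and 1 from four others in each unit dominates at cost 10k.  Conversely, each unit
-- splits into 9 parts lying in closed neighbourhoods, so mp ≤ 9k; and 30 tokens per unit, at most 3r of
-- them in any ball of radius r, force every dominating broadcast to cost at least 10k.  Both ball bounds
-- come from the spine position, which changes by at most 1 along an edge: a ball of radius r meets at most
-- 2r + 1 consecutive positions, and a slot function bounds how many packing vertices or tokens these
-- positions carry (balls of radius 1 are counted directly).

module Submission where

open import Defs renaming (sym to adj-sym)
open import Data.Nat using (ℕ; zero; suc; _+_; _*_; _∸_; _/_; _%_; _≤_; _<_; _≡ᵇ_; z≤n; s≤s; z<s; NonZero)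
import Data.Nat as ℕ
open import Data.Nat.Properties hiding (_≟_)
open import Data.Nat.DivMod using (m≡m%n+[m/n]*n; m%n<n; m*n/n≡m; /-congˡ; /-monoˡ-≤; +-distrib-/-∣ʳ; m<n*o⇒m/o<n)
open import Data.Nat.Divisibility using (divides)
open import Data.Nat.ListAction using () renaming (sum to sumˡ)
open import Data.Nat.Tactic.RingSolver using (solve; solve-∀)
open import Data.Fin using (Fin; zero; suc; toℕ; #_; _≟_; fromℕ; fromℕ<; inject₁; _↑ˡ_; _↑ʳ_; quotient; remainder; combine)
open import Data.Fin.Properties
  using (all?; any?; toℕ-injective; toℕ<n; toℕ≤pred[n]; toℕ-fromℕ; toℕ-fromℕ<; toℕ-inject₁; toℕ-combine;
         splitAt-↑ˡ; splitAt-↑ʳ; remQuot-combine; combine-remQuot)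
import Data.Fin.Properties as Fin
open import Data.Fin.Subset using (Subset; inside; outside; _∈_; _∉_; _⊆_; ∣_∣; ⁅_⁆; _∪_)
open import Data.Fin.Subset.Properties
  using (x∈p∪q⁻; x∈p∪q⁺; x∈⁅y⁆⇒x≡y; x∈⁅x⁆; x≢y⇒x∉⁅y⁆; ∣⁅x⁆∣≡1; p⊂q⇒∣p∣<∣q∣;
         Empty-unique; ∣⊥∣≡0)
open import Data.Vec using ([]; _∷_; here; there; lookup; tabulate)
open import Data.Vec.Properties using (lookup∘tabulate; []=⇒lookup; lookup⇒[]=)
open import Data.Bool using (Bool; true; false; not; _∧_; if_then_else_)
import Data.Bool as Bool
open import Data.Bool.ListAction using (any)
open import Data.List as List using (List; []; _∷_; _++_; length; map; filter; allFin; upTo)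
open import Data.List.Properties using (length-removeAt′; map-tabulate; length-upTo; length-++; length-map)
open import Data.List.Relation.Unary.Any as Any using (here; there)
import Data.List.Relation.Unary.All as All
open import Data.List.Membership.Propositional using () renaming (_∈_ to _∈ˡ_)
open import Data.List.Membership.Propositional.Properties using (∈-allFin; ∈-upTo⁺; ∈-filter⁺; ∈-map⁺; ∈-++⁺ˡ; ∈-++⁺ʳ)
open import Data.List.Extrema.Nat using (argmin; f[argmin]≤f[xs])
open import Data.Product using (Σ; ∃-syntax; _×_; _,_; proj₁; proj₂)
open import Data.Sum using (_⊎_; inj₁; inj₂; [_,_]′)
open import Function using (_∘_; id)
open import Function.Bundles using (mk⇔)
open import Function.Definitions using (Injective)
open import Relation.Binary using (tri<; tri≈; tri>)
open import Relation.Binary.PropositionalEquality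
open import Relation.Nullary using (¬_; Dec; yes; no; does; contradiction)
open import Relation.Nullary.Decidable
  using (from-yes; map′; toSum; _×-dec_; _⊎-dec_; _→-dec_; ¬?; dec-true; dec-false; does-⇔)
open import Algebra.Properties.CommutativeSemigroup +-commutativeSemigroup using (xy∙z≈xz∙y) renaming (interchange to +-interchange)
open import Algebra.Properties.Semiring.Sum +-*-semiring
  using (sum; sum-syntax; ∑-comm; sum-cong-≗; sum-replicate-zero; *-distribˡ-sum)

module _ (G : Graph) where

  Adj-sym : ∀ {u v} → Adj G u v → Adj G v u
  Adj-sym {u} {v} a = trans (adj-sym G v u) a

  Reach-weaken : ∀ {r s u v} → r ≤ s → Reach G r u v → Reach G s u v
  Reach-weaken _ here = here
  Reach-weaken (s≤s r≤s) (step a p) = step a (Reach-weaken r≤s p)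

  Reach-++ : ∀ {r s u w v} → Reach G r u w → Reach G s w v → Reach G (r + s) u v
  Reach-++ {r} {s} here q = Reach-weaken (m≤n+m s r) q
  Reach-++ (step a p) q = step a (Reach-++ p q)

  Reach-sym : ∀ {r u v} → Reach G r u v → Reach G r v u
  Reach-sym here = here
  Reach-sym {suc r} {u} {v} (step a p) =
    subst (λ s → Reach G s v u) (+-comm r 1) (Reach-++ (Reach-sym p) (step (Adj-sym a) here))

  reach? : ∀ r u v → Dec (Reach G r u v)
  reach? r u v with u ≟ v
  ... | yes refl = yes here
  reach? zero u v | no u≢v = no λ { here → u≢v refl }
  reach? (suc r) u v | no u≢v = map′ (λ (w , a , p) → step a p) walk-start
    (any? λ w → (adj G u w Bool.≟ true) ×-dec reach? r w v)
    where
    walk-start : Reach G (suc r) u v → ∃[ w ] (Adj G u w × Reach G r w v)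
    walk-start here = contradiction refl u≢v
    walk-start (step a p) = _ , a , p

  Reach-map : ∀ {H : Graph} (h : Fin (n G) → Fin (n H)) → (∀ {u v} → Adj G u v → Adj H (h u) (h v)) →
    ∀ {r u v} → Reach G r u v → Reach H r (h u) (h v)
  Reach-map h h-hom here = here
  Reach-map h h-hom (step a p) = step (h-hom a) (Reach-map h h-hom p)

  Lipschitz : (Fin (n G) → ℕ) → Set
  Lipschitz p = ∀ {u v} → Adj G u v → p v ≤ suc (p u)

  module _ {p : Fin (n G) → ℕ} (p-lip : Lipschitz p) where

    Reach⇒≤+ : ∀ {r u v} → Reach G r u v → p v ≤ r + p u
    Reach⇒≤+ here = m≤n+m _ _
    Reach⇒≤+ {suc r} {u} (step {w = w} a q) = begin
      p _           ≤⟨ Reach⇒≤+ q ⟩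
      r + p w       ≤⟨ +-monoʳ-≤ r (p-lip a) ⟩
      r + suc (p u) ≡⟨ +-suc r (p u) ⟩
      suc r + p u   ∎
      where open ≤-Reasoning

    Reach⇒∸≤ : ∀ {r u v} → Reach G r u v → p u ∸ r ≤ p v
    Reach⇒∸≤ q = m≤n+o⇒m∸n≤o _ _ (Reach⇒≤+ (Reach-sym q))

  descent⇒Reach : (h : Fin (n G) → ℕ) (root : Fin (n G)) →
    (∀ {u} → h u ≡ 0 → u ≡ root) →
    (∀ {u d} → h u ≡ suc d → ∃[ w ] (Adj G u w × h w ≡ d)) →
    ∀ u → Reach G (h u) u root
  descent⇒Reach h root h-root h-descent u = go (h u) u refl
    where
    go : ∀ d u → h u ≡ d → Reach G d u root
    go zero u hu≡0 = subst (Reach G 0 u) (h-root hu≡0) here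
    go (suc d) u hu≡d+1 with w , a , hw≡d ← h-descent hu≡d+1 = step a (go d w hw≡d)

-- Perfect elimination orders

record PerfectEliminationOrder (G : Graph) : Set where
  field
    rank : Fin (n G) → ℕ
    rank-injective : Injective _≡_ _≡_ rank
    later-neighbours-adjacent : ∀ {u v w} → Adj G u v → Adj G u w →
      rank u < rank v → rank u < rank w → v ≢ w → Adj G v w

CycNext-successor : ∀ {m} (i : Fin (suc m)) → ∃[ j ] CycNext (suc m) i j
CycNext-successor {m} i with toℕ i ℕ.≟ m
... | yes i≡m = zero , inj₂ (i≡m , refl)
... | no i≢m = fromℕ< i+1<m+1 , inj₁ (toℕ-fromℕ< i+1<m+1)
  where
  i+1<m+1 : suc (toℕ i) < suc m
  i+1<m+1 = s≤s (≤∧≢⇒< (toℕ≤pred[n] i) i≢m)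

CycNext-predecessor : ∀ {m} (i : Fin (suc m)) → ∃[ h ] CycNext (suc m) h i
CycNext-predecessor {m} zero = fromℕ m , inj₂ (toℕ-fromℕ m , refl)
CycNext-predecessor (suc i) = inject₁ i , inj₁ (cong suc (sym (toℕ-inject₁ i)))

CycNext-irreflexive : ∀ {m} {i j : Fin (2 + m)} → CycNext (2 + m) i j → i ≢ j
CycNext-irreflexive (inj₁ j≡1+i) refl = <⇒≢ (n<1+n _) j≡1+i
CycNext-irreflexive (inj₂ (i≡m+1 , i≡0)) refl = 0≢1+n (trans (sym i≡0) i≡m+1)

-- CycNext m i j is CycNextℕ m (toℕ i) (toℕ j); over ℕ the case analysis can unify the indices.
CycNextℕ : ℕ → ℕ → ℕ → Set
CycNextℕ m a b = (b ≡ suc a) ⊎ (a ≡ m ∸ 1 × b ≡ 0)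

CycNextℕ-apart : ∀ m {a b c} → CycNextℕ (4 + m) a b → CycNextℕ (4 + m) b c →
  a ≢ c × ¬ CycNextℕ (4 + m) a c × ¬ CycNextℕ (4 + m) c a
CycNextℕ-apart m {a} (inj₁ refl) (inj₁ refl) =
  <⇒≢ (m<n+m a {2} z<s) ,
  (λ { (inj₁ e) → <⇒≢ (n<1+n (suc a)) (sym e) ; (inj₂ (_ , ())) }) ,
  (λ { (inj₁ e) → <⇒≢ (m<n+m a {3} z<s) e ; (inj₂ (() , refl)) })
CycNextℕ-apart m (inj₁ refl) (inj₂ (refl , refl)) =
  (λ ()) ,
  (λ { (inj₁ ()) ; (inj₂ (e , _)) → <⇒≢ (n<1+n (2 + m)) e }) ,
  (λ { (inj₁ ()) ; (inj₂ (() , _)) })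
CycNextℕ-apart m (inj₂ (refl , refl)) (inj₁ refl) =
  (λ ()) , (λ { (inj₁ ()) ; (inj₂ (_ , ())) }) , (λ { (inj₁ ()) ; (inj₂ (() , _)) })
CycNextℕ-apart m (inj₂ (_ , refl)) (inj₂ (() , _))

module _ {G : Graph} (peo : PerfectEliminationOrder G) where
  open PerfectEliminationOrder peo

  minimal-rank-vertex : ∀ {m} (C : Cycle G (suc m)) → ∃[ i ] (∀ j → rank (vert C i) ≤ rank (vert C j))
  minimal-rank-vertex {m} C = i , λ j → All.lookup (f[argmin]≤f[xs] {f = rank ∘ vert C} zero (allFin (suc m))) (∈-allFin j)
    where
    i = argmin (rank ∘ vert C) zero (allFin (suc m))

  peo⇒chordal : Chordal G
  peo⇒chordal .(4 + m) (s≤s (s≤s (s≤s (s≤s {n = m} _)))) C =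
    h , j , h≢j , h↛j , j↛h ,
    later-neighbours-adjacent (Adj-sym G (edges C h i h→i)) (edges C i j i→j)
      (rank< h (CycNext-irreflexive h→i)) (rank< j (CycNext-irreflexive i→j ∘ sym))
      (h≢j ∘ inj C)
    where
    i = proj₁ (minimal-rank-vertex C)
    h→i = proj₂ (CycNext-predecessor i)
    i→j = proj₂ (CycNext-successor i)
    h = proj₁ (CycNext-predecessor i)
    j = proj₁ (CycNext-successor i)
    apart = CycNextℕ-apart m h→i i→j
    h≢j : h ≢ j
    h≢j = proj₁ apart ∘ cong toℕ
    h↛j = proj₁ (proj₂ apart)
    j↛h = proj₂ (proj₂ apart)
    rank< : ∀ k → k ≢ i → rank (vert C i) < rank (vert C k)
    rank< k k≢i = ≤∧≢⇒< (proj₂ (minimal-rank-vertex C) k) (k≢i ∘ sym ∘ inj C ∘ rank-injective)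

∑-mono-≤ : ∀ {n} {f g : Fin n → ℕ} → (∀ i → f i ≤ g i) → sum f ≤ sum g
∑-mono-≤ {zero} _ = z≤n
∑-mono-≤ {suc n} f≤g = +-mono-≤ (f≤g zero) (∑-mono-≤ (f≤g ∘ suc))

∑-δ : ∀ {n} (a : Fin n) x → ∑[ i < n ] (if does (a ≟ i) then x else 0) ≡ x
∑-δ {suc n} zero x = trans (cong (x +_) (sum-replicate-zero n)) (+-identityʳ x)
∑-δ {suc n} (suc a) x = ∑-δ a x

∑-↑ : ∀ m {n} (f : Fin (m + n) → ℕ) → sum f ≡ ∑[ i < m ] f (i ↑ˡ n) + ∑[ j < n ] f (m ↑ʳ j)
∑-↑ zero f = refl
∑-↑ (suc m) f = trans (cong (f zero +_) (∑-↑ m (f ∘ suc))) (sym (+-assoc (f zero) _ _))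

∑-remainder : ∀ k m (f : Fin m → ℕ) → ∑[ u < k * m ] f (remainder {k} m u) ≡ k * sum f
∑-remainder zero m f = refl
∑-remainder (suc k) m f = begin
  ∑[ u < suc k * m ] f (remainder {suc k} m u)
    ≡⟨ ∑-↑ m (f ∘ remainder {suc k} m) ⟩
  ∑[ i < m ] f (remainder {suc k} m (i ↑ˡ k * m)) + ∑[ j < k * m ] f (remainder {suc k} m (m ↑ʳ j))
    ≡⟨ cong₂ _+_ (sum-cong-≗ λ i → cong f (remainder-↑ˡ i)) (sum-cong-≗ λ j → cong f (remainder-↑ʳ j)) ⟩
  sum f + ∑[ j < k * m ] f (remainder {k} m j)
    ≡⟨ cong (sum f +_) (∑-remainder k m f) ⟩
  sum f + k * sum f ∎
  where
  open ≡-Reasoning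
  remainder-↑ˡ : ∀ i → remainder {suc k} m (i ↑ˡ k * m) ≡ i
  remainder-↑ˡ i rewrite splitAt-↑ˡ m i (k * m) = refl
  remainder-↑ʳ : ∀ j → remainder {suc k} m (m ↑ʳ j) ≡ remainder {k} m j
  remainder-↑ʳ j rewrite splitAt-↑ʳ m (k * m) j = refl

cost≡∑ : ∀ G (f : Fin (n G) → ℕ) → cost G f ≡ sum f
cost≡∑ G f = trans (cong sumˡ (map-tabulate id f)) (sumˡ-tabulate f)
  where
  sumˡ-tabulate : ∀ {n} (f : Fin n → ℕ) → sumˡ (List.tabulate f) ≡ sum f
  sumˡ-tabulate {zero} f = refl
  sumˡ-tabulate {suc n} f = cong (f zero +_) (sumˡ-tabulate (f ∘ suc))

∈-tabulate⁻ : ∀ {n} {P : Fin n → Bool} {u} → u ∈ tabulate P → P u ≡ true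
∈-tabulate⁻ {P = P} {u} u∈ = trans (sym (lookup∘tabulate P u)) ([]=⇒lookup u∈)

∈-─ : ∀ {A : Set} {x y : A} {xs : List A} (x∈xs : x ∈ˡ xs) → y ∈ˡ xs → y ≢ x → y ∈ˡ (xs Any.─ x∈xs)
∈-─ (here refl) (here y≡x) y≢x = contradiction y≡x y≢x
∈-─ (here refl) (there y∈xs) _ = y∈xs
∈-─ (there x∈xs) (here y≡z) _ = here y≡z
∈-─ (there x∈xs) (there y∈xs) y≢x = there (∈-─ x∈xs y∈xs y≢x)

∣p∣≤length : ∀ {n} {A : Set} (p : Subset n) (g : Fin n → A) (xs : List A) →
  (∀ {u v} → u ∈ p → v ∈ p → g u ≡ g v → u ≡ v) → (∀ {u} → u ∈ p → g u ∈ˡ xs) → ∣ p ∣ ≤ length xs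
∣p∣≤length [] g xs _ _ = z≤n
∣p∣≤length (outside ∷ p) g xs g-inj g∈xs =
  ∣p∣≤length p (g ∘ suc) xs (λ u∈p v∈p e → Fin.suc-injective (g-inj (there u∈p) (there v∈p) e)) (g∈xs ∘ there)
∣p∣≤length (inside ∷ p) g xs g-inj g∈xs = begin
  suc ∣ p ∣                     ≤⟨ s≤s (∣p∣≤length p (g ∘ suc) (xs Any.─ g₀∈xs) g∘suc-inj g∘suc∈xs─g₀) ⟩
  suc (length (xs Any.─ g₀∈xs)) ≡⟨ length-removeAt′ xs (Any.index g₀∈xs) ⟨
  length xs                     ∎
  where
  open ≤-Reasoning
  g₀∈xs = g∈xs here
  g∘suc-inj : ∀ {u v} → u ∈ p → v ∈ p → g (suc u) ≡ g (suc v) → u ≡ v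
  g∘suc-inj u∈p v∈p e = Fin.suc-injective (g-inj (there u∈p) (there v∈p) e)
  g∘suc∈xs─g₀ : ∀ {u} → u ∈ p → g (suc u) ∈ˡ (xs Any.─ g₀∈xs)
  g∘suc∈xs─g₀ u∈p = ∈-─ g₀∈xs (g∈xs (there u∈p)) (λ e → 0≢suc (g-inj here (there u∈p) (sym e)))
    where
    0≢suc : ∀ {u : Fin _} → zero ≢ suc u
    0≢suc ()

empty⇒∣p∣≡0 : ∀ {n} (p : Subset n) → (∀ {u} → u ∉ p) → ∣ p ∣ ≡ 0
empty⇒∣p∣≡0 {n} p empty = trans (cong ∣_∣ (Empty-unique λ (_ , u∈p) → empty u∈p)) (∣⊥∣≡0 n)

x≢y⇒2≤∣⁅x⁆∪⁅y⁆∣ : ∀ {n} {u v : Fin n} → u ≢ v → 2 ≤ ∣ ⁅ u ⁆ ∪ ⁅ v ⁆ ∣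
x≢y⇒2≤∣⁅x⁆∪⁅y⁆∣ {u = u} {v} u≢v = subst (λ s → suc s ≤ ∣ ⁅ u ⁆ ∪ ⁅ v ⁆ ∣) (∣⁅x⁆∣≡1 u)
  (p⊂q⇒∣p∣<∣q∣ ((λ x∈ → x∈p∪q⁺ (inj₁ x∈)) ,
                v , x∈p∪q⁺ (inj₂ (x∈⁅x⁆ v)) , x≢y⇒x∉⁅y⁆ (u≢v ∘ sym)))

⟦_⟧ : Bool → ℕ
⟦ b ⟧ = if b then 1 else 0

∣p∣≡∑ : ∀ {n} (p : Subset n) → ∣ p ∣ ≡ ∑[ u < n ] ⟦ lookup p u ⟧
∣p∣≡∑ [] = refl
∣p∣≡∑ (inside ∷ p) = cong suc (∣p∣≡∑ p)
∣p∣≡∑ (outside ∷ p) = ∣p∣≡∑ p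

∣tabulate∣≡∑ : ∀ {n} (P : Fin n → Bool) → ∣ tabulate P ∣ ≡ ∑[ u < n ] ⟦ P u ⟧
∣tabulate∣≡∑ P = trans (∣p∣≡∑ (tabulate P)) (sum-cong-≗ λ u → cong ⟦_⟧ (lookup∘tabulate P u))

∣tabulate∘remainder∣ : ∀ k m (P : Fin m → Bool) → ∣ tabulate (P ∘ remainder {k} m) ∣ ≡ k * ∣ tabulate P ∣
∣tabulate∘remainder∣ k m P = begin
  ∣ tabulate (P ∘ remainder {k} m) ∣       ≡⟨ ∣tabulate∣≡∑ (P ∘ remainder {k} m) ⟩
  ∑[ u < k * m ] ⟦ P (remainder {k} m u) ⟧ ≡⟨ ∑-remainder k m (⟦_⟧ ∘ P) ⟩
  k * ∑[ o < m ] ⟦ P o ⟧                   ≡⟨ cong (k *_) (∣tabulate∣≡∑ P) ⟨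
  k * ∣ tabulate P ∣                       ∎
  where open ≡-Reasoning

∣p∣≡∑fibres : ∀ {n m} (p : Subset n) (g : Fin n → Fin m) →
  ∣ p ∣ ≡ ∑[ v < m ] ∣ tabulate (λ u → lookup p u ∧ does (g u ≟ v)) ∣
∣p∣≡∑fibres {n} {m} p g = begin
  ∣ p ∣
    ≡⟨ ∣p∣≡∑ p ⟩
  ∑[ u < n ] ⟦ lookup p u ⟧
    ≡⟨ sum-cong-≗ (λ u → trans (sym (∑-δ (g u) _)) (sum-cong-≗ λ v → if-⟦∧⟧ (lookup p u) (does (g u ≟ v)))) ⟩
  ∑[ u < n ] ∑[ v < m ] ⟦ fibre v u ⟧
    ≡⟨ ∑-comm (λ u v → ⟦ fibre v u ⟧) ⟩
  ∑[ v < m ] ∑[ u < n ] ⟦ fibre v u ⟧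
    ≡⟨ sum-cong-≗ (λ v → ∣tabulate∣≡∑ (fibre v)) ⟨
  ∑[ v < m ] ∣ tabulate (fibre v) ∣ ∎
  where
  open ≡-Reasoning
  fibre : Fin m → Fin n → Bool
  fibre v u = lookup p u ∧ does (g u ≟ v)
  if-⟦∧⟧ : ∀ b d → (if d then ⟦ b ⟧ else 0) ≡ ⟦ b ∧ d ⟧
  if-⟦∧⟧ false true = refl
  if-⟦∧⟧ false false = refl
  if-⟦∧⟧ true d = refl

-- Broadcasts from below, multipackings from above

-- |N_r[v] ∩ T| ≤ c r for all v and r ≥ 1.  With c = 1 this is Multipacking, and
-- ScaledMultipacking⇒≤cost below becomes the weak duality mp ≤ γ_b.
ScaledMultipacking : (G : Graph) → ℕ → Subset (n G) → Set
ScaledMultipacking G c T = ∀ v r → 1 ≤ r → (S : Subset (n G)) → S ⊆ T →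
  (∀ {u} → u ∈ S → Reach G r v u) → ∣ S ∣ ≤ c * r

module _ (G : Graph) where

  ScaledMultipacking⇒≤cost : ∀ {c T} → ScaledMultipacking G c T →
    ∀ f → Dominating G f → ∣ T ∣ ≤ c * cost G f
  ScaledMultipacking⇒≤cost {c} {T} T-sparse f f-dom = begin
    ∣ T ∣                    ≡⟨ ∣p∣≡∑fibres T dominator ⟩
    ∑[ v < n G ] ∣ fibre v ∣ ≤⟨ ∑-mono-≤ fibre-bound ⟩
    ∑[ v < n G ] (c * f v)   ≡⟨ *-distribˡ-sum c f ⟨
    c * sum f                ≡⟨ cong (c *_) (cost≡∑ G f) ⟨
    c * cost G f             ∎
    where
    open ≤-Reasoning
    dominator : Fin (n G) → Fin (n G)
    dominator u = proj₁ (f-dom u)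
    fibre : Fin (n G) → Subset (n G)
    fibre v = tabulate (λ u → lookup T u ∧ does (dominator u ≟ v))
    fibre⊆T : ∀ {v u} → u ∈ fibre v → u ∈ T × dominator u ≡ v
    fibre⊆T {v} {u} u∈ with lookup T u in Tu | dominator u ≟ v | ∈-tabulate⁻ u∈
    ... | true | yes du≡v | _ = lookup⇒[]= u T Tu , du≡v
    fibre-bound : ∀ v → ∣ fibre v ∣ ≤ c * f v
    fibre-bound v with f v in fv
    ... | zero = ≤-reflexive (trans (empty⇒∣p∣≡0 (fibre v) λ u∈ →
      let _ , du≡v = fibre⊆T u∈ in
      <⇒≢ (proj₁ (proj₂ (f-dom _))) (sym (trans (cong f du≡v) fv))) (sym (*-zeroʳ c)))
    ... | suc r = T-sparse v (suc r) (s≤s z≤n) (fibre v) (proj₁ ∘ fibre⊆T) λ u∈ →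
      let _ , du≡v = fibre⊆T u∈ in
      subst₂ (λ w s → Reach G s w _) du≡v (trans (cong f du≡v) fv) (proj₂ (proj₂ (f-dom _)))

  Multipacking⇒≤ : ∀ m (part : Fin (n G) → ℕ) → (∀ u → part u < m) →
    (∀ {u v} → part u ≡ part v → ∃[ w ] (Reach G 1 w u × Reach G 1 w v)) →
    ∀ {M} → Multipacking G M → ∣ M ∣ ≤ m
  Multipacking⇒≤ m part part<m part-cover {M} M-mp =
    subst (∣ M ∣ ≤_) (length-upTo m) (∣p∣≤length M part (upTo m) part-injective (λ {u} _ → ∈-upTo⁺ (part<m u)))
    where
    part-injective : ∀ {u v} → u ∈ M → v ∈ M → part u ≡ part v → u ≡ v
    part-injective {u} {v} u∈M v∈M same-part with u ≟ v
    ... | yes u≡v = u≡v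
    ... | no u≢v = contradiction (M-mp w 1 (s≤s z≤n) (⁅ u ⁆ ∪ ⁅ v ⁆) pair⊆M pair-near-w)
                                 (<⇒≱ (x≢y⇒2≤∣⁅x⁆∪⁅y⁆∣ u≢v))
      where
      w = proj₁ (part-cover same-part)
      pair⊆M : ⁅ u ⁆ ∪ ⁅ v ⁆ ⊆ M
      pair⊆M x∈ with x∈p∪q⁻ ⁅ u ⁆ ⁅ v ⁆ x∈
      ... | inj₁ x∈⁅u⁆ = subst (_∈ M) (sym (x∈⁅y⁆⇒x≡y u x∈⁅u⁆)) u∈M
      ... | inj₂ x∈⁅v⁆ = subst (_∈ M) (sym (x∈⁅y⁆⇒x≡y v x∈⁅v⁆)) v∈M
      pair-near-w : ∀ {x} → x ∈ ⁅ u ⁆ ∪ ⁅ v ⁆ → Reach G 1 w x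
      pair-near-w x∈ with x∈p∪q⁻ ⁅ u ⁆ ⁅ v ⁆ x∈
      ... | inj₁ x∈⁅u⁆ = subst (Reach G 1 w) (sym (x∈⁅y⁆⇒x≡y u x∈⁅u⁆)) (proj₁ (proj₂ (part-cover same-part)))
      ... | inj₂ x∈⁅v⁆ = subst (Reach G 1 w) (sym (x∈⁅y⁆⇒x≡y v x∈⁅v⁆)) (proj₂ (proj₂ (part-cover same-part)))

  -- The members u of T get distinct slots σ (p u) + e u, and a ball of radius r around v only meets
  -- positions in [p v ∸ r, p v + r], hence only slots in [σ (p v ∸ r), σ (p v + r + 1)).
  window-bound : ∀ {p} → Lipschitz G p → ∀ (T : Subset (n G)) (σ : ℕ → ℕ) (e : Fin (n G) → ℕ) →
    (∀ {a b} → a ≤ b → σ a ≤ σ b) →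
    (∀ {u} → u ∈ T → σ (p u) + e u < σ (suc (p u))) →
    (∀ {u v} → u ∈ T → v ∈ T → p u ≡ p v → e u ≡ e v → u ≡ v) →
    ∀ v r (S : Subset (n G)) → S ⊆ T → (∀ {u} → u ∈ S → Reach G r v u) →
    ∣ S ∣ ≤ σ (suc (r + p v)) ∸ σ (p v ∸ r)
  window-bound {p} p-lip T σ e σ-mono σ-step label-injective v r S S⊆T S-near =
    subst (∣ S ∣ ≤_) (length-upTo (hi ∸ lo)) (∣p∣≤length S (λ u → slot u ∸ lo) (upTo (hi ∸ lo)) shifted-injective
      λ u∈S → ∈-upTo⁺ (∸-monoˡ-< (slot<hi u∈S) (lo≤slot u∈S)))
    where
    lo hi : ℕ
    lo = σ (p v ∸ r)
    hi = σ (suc (r + p v))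
    slot : Fin (n G) → ℕ
    slot u = σ (p u) + e u
    lo≤slot : ∀ {u} → u ∈ S → lo ≤ slot u
    lo≤slot u∈S = ≤-trans (σ-mono (Reach⇒∸≤ G p-lip (S-near u∈S))) (m≤m+n _ _)
    slot<hi : ∀ {u} → u ∈ S → slot u < hi
    slot<hi u∈S = ≤-trans (σ-step (S⊆T u∈S)) (σ-mono (s≤s (Reach⇒≤+ G p-lip (S-near u∈S))))
    slot-mono : ∀ {u u'} → u ∈ S → p u < p u' → slot u < slot u'
    slot-mono u∈S pu<pu' = ≤-trans (σ-step (S⊆T u∈S)) (≤-trans (σ-mono pu<pu') (m≤m+n _ _))
    slot-injective : ∀ {u u'} → u ∈ S → u' ∈ S → slot u ≡ slot u' → u ≡ u'
    slot-injective {u} {u'} u∈S u'∈S same-slot with <-cmp (p u) (p u')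
    ... | tri< pu<pu' _ _ = contradiction same-slot (<⇒≢ (slot-mono u∈S pu<pu'))
    ... | tri> _ _ pu>pu' = contradiction (sym same-slot) (<⇒≢ (slot-mono u'∈S pu>pu'))
    ... | tri≈ _ pu≡pu' _ = label-injective (S⊆T u∈S) (S⊆T u'∈S) pu≡pu'
      (+-cancelˡ-≡ (σ (p u)) _ _ (trans same-slot (cong (λ x → σ x + e u') (sym pu≡pu'))))
    shifted-injective : ∀ {u u'} → u ∈ S → u' ∈ S → slot u ∸ lo ≡ slot u' ∸ lo → u ≡ u'
    shifted-injective u∈S u'∈S eq = slot-injective u∈S u'∈S (∸-cancelʳ-≡ (lo≤slot u∈S) (lo≤slot u'∈S) eq)

/-+-multiple : ∀ m k d .{{_ : NonZero d}} → (m + k * d) / d ≡ m / d + k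
/-+-multiple m k d = trans (+-distrib-/-∣ʳ m (divides k refl)) (cong (m / d +_) (m*n/n≡m k d))

/-+-≤ : ∀ a b d → (a + b) / suc d ≤ a / suc d + (b + d) / suc d
/-+-≤ a b d = begin
  (a + b) / suc d                                ≡⟨ /-congˡ (cong (_+ b) (m≡m%n+[m/n]*n a (suc d))) ⟩
  (a % suc d + a / suc d * suc d + b) / suc d    ≡⟨ /-congˡ (xy∙z≈xz∙y (a % suc d) _ b) ⟩
  (a % suc d + b + a / suc d * suc d) / suc d    ≡⟨ /-+-multiple (a % suc d + b) (a / suc d) (suc d) ⟩
  (a % suc d + b) / suc d + a / suc d
    ≤⟨ +-monoˡ-≤ (a / suc d) (/-monoˡ-≤ (suc d) (+-monoˡ-≤ b (≤-pred (m%n<n a (suc d))))) ⟩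
  (d + b) / suc d + a / suc d                    ≡⟨ cong (λ x → x / suc d + a / suc d) (+-comm d b) ⟩
  (b + d) / suc d + a / suc d                    ≡⟨ +-comm _ (a / suc d) ⟩
  a / suc d + (b + d) / suc d                    ∎
  where open ≤-Reasoning

-- The ball of radius r around position p lies in [p ∸ r, p + r], a window of 2r + 1 positions.
slot-window : ∀ (σ g : ℕ → ℕ) → (∀ {a b} → a ≤ b → σ a ≤ σ b) → (∀ y m → σ (y + m) ≤ σ y + g m) →
  ∀ p r → σ (suc (r + p)) ∸ σ (p ∸ r) ≤ g (suc (r + r))
slot-window σ g σ-mono σ-growth p r = begin
  σ (suc (r + p)) ∸ σ y       ≤⟨ ∸-monoˡ-≤ (σ y) (σ-mono window) ⟩
  σ (y + suc (r + r)) ∸ σ y   ≤⟨ ∸-monoˡ-≤ (σ y) (σ-growth y (suc (r + r))) ⟩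
  σ y + g (suc (r + r)) ∸ σ y ≡⟨ m+n∸m≡n (σ y) _ ⟩
  g (suc (r + r))             ∎
  where
  open ≤-Reasoning
  y = p ∸ r
  window : suc (r + p) ≤ y + suc (r + r)
  window = begin
    suc (r + p)       ≤⟨ s≤s (+-monoʳ-≤ r (m≤n+m∸n p r)) ⟩
    suc (r + (r + y)) ≡⟨ cong suc (trans (+-comm y (r + r)) (+-assoc r r y)) ⟨
    suc (y + (r + r)) ≡⟨ +-suc y (r + r) ⟨
    y + suc (r + r)   ∎

-- Position p owns the slots [tokenSlot p, tokenSlot (suc p)): two of them when p ≡ 1 (mod 9),
-- where a unit carries two tokens, and one otherwise.
tokenSlot : ℕ → ℕ
tokenSlot p = p + (p + 7) / 9

tokenSlot-mono : ∀ {a b} → a ≤ b → tokenSlot a ≤ tokenSlot b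
tokenSlot-mono a≤b = +-mono-≤ a≤b (/-monoˡ-≤ 9 (+-monoˡ-≤ 7 a≤b))

tokenSlot-+27 : ∀ q l → tokenSlot (q * 27 + l) ≡ q * 30 + tokenSlot l
tokenSlot-+27 q l = begin
  q * 27 + l + (q * 27 + l + 7) / 9  ≡⟨ cong (λ x → q * 27 + l + x / 9) (regroup q l) ⟩
  q * 27 + l + (l + 7 + q * 3 * 9) / 9 ≡⟨ cong (q * 27 + l +_) (/-+-multiple (l + 7) (q * 3) 9) ⟩
  q * 27 + l + ((l + 7) / 9 + q * 3) ≡⟨ rearrange q l ((l + 7) / 9) ⟩
  q * 30 + (l + (l + 7) / 9)         ∎
  where
  open ≡-Reasoning
  regroup : ∀ q l → q * 27 + l + 7 ≡ l + 7 + q * 3 * 9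
  regroup = solve-∀
  rearrange : ∀ q l x → q * 27 + l + (x + q * 3) ≡ q * 30 + (l + x)
  rearrange = solve-∀

2r+1+⌈[2r+1]/9⌉≤3r : ∀ {r} → 2 ≤ r → suc (r + r) + (suc (r + r) + 8) / 9 ≤ 3 * r
2r+1+⌈[2r+1]/9⌉≤3r {r@(suc (suc t))} (s≤s (s≤s z≤n)) = begin
  suc (r + r) + (suc (r + r) + 8) / 9 ≤⟨ +-monoʳ-≤ (suc (r + r)) (≤-pred (m<n*o⇒m/o<n {o = 9} 2r+9<9r)) ⟩
  suc (r + r) + suc t                 ≡⟨ solve List.[ t ] ⟩
  3 * r                               ∎
  where
  open ≤-Reasoning
  2r+9<9r : suc (r + r) + 8 < r * 9
  2r+9<9r = begin-strict
    suc (r + r) + 8 ≡⟨ solve List.[ t ] ⟩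
    13 + 2 * t      <⟨ +-mono-<-≤ (m<m+n 13 {5} z<s) (*-monoˡ-≤ t (m≤m+n 2 7)) ⟩
    18 + 9 * t      ≡⟨ solve List.[ t ] ⟩
    r * 9           ∎

tokenSlot-window : ∀ p r → 2 ≤ r → tokenSlot (suc (r + p)) ∸ tokenSlot (p ∸ r) ≤ 3 * r
tokenSlot-window p r 2≤r = ≤-trans (slot-window tokenSlot (λ m → m + (m + 8) / 9) tokenSlot-mono growth p r) (2r+1+⌈[2r+1]/9⌉≤3r 2≤r)
  where
  growth : ∀ y m → tokenSlot (y + m) ≤ tokenSlot y + (m + (m + 8) / 9)
  growth y m = begin
    y + m + (y + m + 7) / 9               ≡⟨ cong (λ x → y + m + x / 9) (xy∙z≈xz∙y y m 7) ⟩
    y + m + (y + 7 + m) / 9               ≤⟨ +-monoʳ-≤ (y + m) (/-+-≤ (y + 7) m 8) ⟩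
    y + m + ((y + 7) / 9 + (m + 8) / 9)   ≡⟨ +-interchange y m ((y + 7) / 9) ((m + 8) / 9) ⟩
    y + (y + 7) / 9 + (m + (m + 8) / 9)   ∎
    where open ≤-Reasoning

packingSlot : ℕ → ℕ
packingSlot p = (p + 2) / 3

packingSlot-mono : ∀ {a b} → a ≤ b → packingSlot a ≤ packingSlot b
packingSlot-mono a≤b = /-monoˡ-≤ 3 (+-monoˡ-≤ 2 a≤b)

packingSlot-+27 : ∀ q l → packingSlot (q * 27 + l) ≡ q * 9 + packingSlot l
packingSlot-+27 q l = begin
  (q * 27 + l + 2) / 3       ≡⟨ cong (_/ 3) (regroup q l) ⟩
  (l + 2 + q * 9 * 3) / 3    ≡⟨ /-+-multiple (l + 2) (q * 9) 3 ⟩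
  (l + 2) / 3 + q * 9        ≡⟨ +-comm _ (q * 9) ⟩
  q * 9 + (l + 2) / 3        ∎
  where
  open ≡-Reasoning
  regroup : ∀ q l → q * 27 + l + 2 ≡ l + 2 + q * 9 * 3
  regroup = solve-∀

⌈[2r+1]/3⌉≤r : ∀ {r} → 1 ≤ r → (suc (r + r) + 2) / 3 ≤ r
⌈[2r+1]/3⌉≤r {r@(suc t)} _ = ≤-pred (m<n*o⇒m/o<n {o = 3} (begin-strict
  suc (r + r) + 2 ≡⟨ solve List.[ t ] ⟩
  5 + 2 * t       <⟨ +-mono-<-≤ (m<m+n 5 {1} z<s) (*-monoˡ-≤ t (m≤m+n 2 1)) ⟩
  6 + 3 * t       ≡⟨ solve List.[ t ] ⟩
  suc r * 3       ∎))
  where open ≤-Reasoning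

packingSlot-window : ∀ p r → 1 ≤ r → packingSlot (suc (r + p)) ∸ packingSlot (p ∸ r) ≤ r
packingSlot-window p r 1≤r = ≤-trans (slot-window packingSlot (λ m → (m + 2) / 3) packingSlot-mono growth p r) (⌈[2r+1]/3⌉≤r 1≤r)
  where
  growth : ∀ y m → packingSlot (y + m) ≤ packingSlot y + (m + 2) / 3
  growth y m = subst (λ x → x / 3 ≤ packingSlot y + (m + 2) / 3) (sym (xy∙z≈xz∙y y m 2)) (/-+-≤ (y + 2) m 2)

*+-injective : ∀ m {a b c d} → b < m → d < m → a * m + b ≡ c * m + d → a ≡ c × b ≡ d
*+-injective m {zero} {b} {zero} b<m d<m e = refl , e
*+-injective m {zero} {b} {suc c} {d} b<m d<m e = contradiction (subst (m ≤_) (sym e) (≤-trans (m≤m+n m (c * m)) (m≤m+n _ d))) (<⇒≱ b<m)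
*+-injective m {suc a} {b} {zero} b<m d<m e = contradiction (subst (m ≤_) e (≤-trans (m≤m+n m (a * m)) (m≤m+n _ b))) (<⇒≱ d<m)
*+-injective m {suc a} {b} {suc c} {d} b<m d<m e
  with *+-injective m {a} {b} {c} {d} b<m d<m (+-cancelˡ-≡ m _ _ (trans (sym (+-assoc m (a * m) b)) (trans e (+-assoc m (c * m) d))))
... | refl , refl = refl , refl

periodic-step : ∀ (σ : ℕ → ℕ) c → (∀ q l → σ (q * 27 + l) ≡ q * c + σ l) →
  ∀ q l e → σ l + e < σ (suc l) → σ (q * 27 + l) + e < σ (suc (q * 27 + l))
periodic-step σ c σ-periodic q l e l-step = begin-strict
  σ (q * 27 + l) + e     ≡⟨ cong (_+ e) (σ-periodic q l) ⟩
  q * c + σ l + e        ≡⟨ +-assoc (q * c) (σ l) e ⟩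
  q * c + (σ l + e)      <⟨ +-monoʳ-< (q * c) l-step ⟩
  q * c + σ (suc l)      ≡⟨ σ-periodic q (suc l) ⟨
  σ (q * 27 + suc l)     ≡⟨ cong σ (+-suc (q * 27) l) ⟩
  σ (suc (q * 27 + l))   ∎
  where open ≤-Reasoning

-- The unit

-- Offsets 0, …, 26 form the spine path; the triangle 27, 28, 29 hangs on the spine vertices 0, 1, 2
-- (27 ~ 0, 1 and 28 ~ 1, 2), and likewise 30–32 on 9–11 and 33–35 on 18–20.  The tables of a unit
-- are opaque: H_k only uses them through the facts verified by exhaustive search below.
opaque
  unitNeighbours : Fin 36 → List ℕ
  unitNeighbours = lookup
    ( (1 ∷ 27 ∷ []) ∷ (0 ∷ 2 ∷ 27 ∷ 28 ∷ []) ∷ (1 ∷ 3 ∷ 28 ∷ []) ∷ (2 ∷ 4 ∷ []) ∷ (3 ∷ 5 ∷ []) ∷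
      (4 ∷ 6 ∷ []) ∷ (5 ∷ 7 ∷ []) ∷ (6 ∷ 8 ∷ []) ∷ (7 ∷ 9 ∷ []) ∷
      (8 ∷ 10 ∷ 30 ∷ []) ∷ (9 ∷ 11 ∷ 30 ∷ 31 ∷ []) ∷ (10 ∷ 12 ∷ 31 ∷ []) ∷ (11 ∷ 13 ∷ []) ∷ (12 ∷ 14 ∷ []) ∷
      (13 ∷ 15 ∷ []) ∷ (14 ∷ 16 ∷ []) ∷ (15 ∷ 17 ∷ []) ∷ (16 ∷ 18 ∷ []) ∷
      (17 ∷ 19 ∷ 33 ∷ []) ∷ (18 ∷ 20 ∷ 33 ∷ 34 ∷ []) ∷ (19 ∷ 21 ∷ 34 ∷ []) ∷ (20 ∷ 22 ∷ []) ∷ (21 ∷ 23 ∷ []) ∷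
      (22 ∷ 24 ∷ []) ∷ (23 ∷ 25 ∷ []) ∷ (24 ∷ 26 ∷ []) ∷ (25 ∷ []) ∷
      (0 ∷ 1 ∷ 28 ∷ 29 ∷ []) ∷ (1 ∷ 2 ∷ 27 ∷ 29 ∷ []) ∷ (27 ∷ 28 ∷ []) ∷
      (9 ∷ 10 ∷ 31 ∷ 32 ∷ []) ∷ (10 ∷ 11 ∷ 30 ∷ 32 ∷ []) ∷ (30 ∷ 31 ∷ []) ∷
      (18 ∷ 19 ∷ 34 ∷ 35 ∷ []) ∷ (19 ∷ 20 ∷ 33 ∷ 35 ∷ []) ∷ (33 ∷ 34 ∷ []) ∷ [])

  unitAdj : Fin 36 → Fin 36 → Bool
  unitAdj a b = any (_≡ᵇ toℕ b) (unitNeighbours a)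

  unitAdj-sym : ∀ a b → unitAdj a b ≡ unitAdj b a
  unitAdj-sym = from-yes (all? λ a → all? λ b → unitAdj a b Bool.≟ unitAdj b a)

  unitAdj-irreflexive : ∀ a → unitAdj a a ≡ false
  unitAdj-irreflexive = from-yes (all? λ a → unitAdj a a Bool.≟ false)

Unit : Graph
Unit = record { n = 36 ; adj = unitAdj ; sym = unitAdj-sym ; irrefl = unitAdj-irreflexive }

opaque
  unitPosition : Fin 36 → ℕ
  unitPosition = lookup (0 ∷ 1 ∷ 2 ∷ 3 ∷ 4 ∷ 5 ∷ 6 ∷ 7 ∷ 8 ∷ 9 ∷ 10 ∷ 11 ∷ 12 ∷ 13 ∷ 14 ∷ 15 ∷ 16 ∷ 17 ∷ 18 ∷
    19 ∷ 20 ∷ 21 ∷ 22 ∷ 23 ∷ 24 ∷ 25 ∷ 26 ∷ 1 ∷ 1 ∷ 1 ∷ 10 ∷ 10 ∷ 10 ∷ 19 ∷ 19 ∷ 19 ∷ [])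

  unitHeight : Fin 36 → ℕ
  unitHeight = lookup (0 ∷ 1 ∷ 2 ∷ 3 ∷ 4 ∷ 5 ∷ 6 ∷ 7 ∷ 8 ∷ 9 ∷ 10 ∷ 11 ∷ 12 ∷ 13 ∷ 14 ∷ 15 ∷ 16 ∷ 17 ∷ 18 ∷
    19 ∷ 20 ∷ 21 ∷ 22 ∷ 23 ∷ 24 ∷ 25 ∷ 26 ∷ 1 ∷ 2 ∷ 2 ∷ 10 ∷ 11 ∷ 11 ∷ 19 ∷ 20 ∷ 20 ∷ [])

  unitRank : Fin 36 → ℕ
  unitRank = lookup (1 ∷ 3 ∷ 5 ∷ 6 ∷ 7 ∷ 8 ∷ 9 ∷ 10 ∷ 11 ∷ 13 ∷ 15 ∷ 17 ∷ 18 ∷ 19 ∷ 20 ∷ 21 ∷ 22 ∷ 23 ∷ 25 ∷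
    27 ∷ 29 ∷ 30 ∷ 31 ∷ 32 ∷ 33 ∷ 34 ∷ 35 ∷ 2 ∷ 4 ∷ 0 ∷ 14 ∷ 16 ∷ 12 ∷ 26 ∷ 28 ∷ 24 ∷ [])

  unitBroadcast : Fin 36 → ℕ
  unitBroadcast = lookup (0 ∷ 0 ∷ 2 ∷ 0 ∷ 0 ∷ 0 ∷ 1 ∷ 0 ∷ 0 ∷ 0 ∷ 2 ∷ 0 ∷ 0 ∷ 0 ∷ 1 ∷ 0 ∷ 0 ∷ 0 ∷ 2 ∷
    0 ∷ 0 ∷ 0 ∷ 1 ∷ 0 ∷ 0 ∷ 1 ∷ 0 ∷ 0 ∷ 0 ∷ 0 ∷ 0 ∷ 0 ∷ 0 ∷ 0 ∷ 0 ∷ 0 ∷ [])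

  unitPart : Fin 36 → ℕ
  unitPart = lookup (0 ∷ 0 ∷ 0 ∷ 1 ∷ 1 ∷ 1 ∷ 2 ∷ 2 ∷ 2 ∷ 3 ∷ 3 ∷ 3 ∷ 4 ∷ 4 ∷ 4 ∷ 5 ∷ 5 ∷ 5 ∷ 6 ∷
    6 ∷ 6 ∷ 7 ∷ 7 ∷ 7 ∷ 8 ∷ 8 ∷ 8 ∷ 0 ∷ 0 ∷ 0 ∷ 3 ∷ 3 ∷ 3 ∷ 6 ∷ 6 ∷ 6 ∷ [])

  unitToken : Fin 36 → Bool
  unitToken o = not (any (_≡ᵇ toℕ o) (1 ∷ 10 ∷ 19 ∷ 28 ∷ 31 ∷ 34 ∷ []))

  unitTieBreak : Fin 36 → ℕ
  unitTieBreak o = if any (_≡ᵇ toℕ o) (29 ∷ 32 ∷ 35 ∷ []) then 1 else 0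

  unitPacking : Fin 36 → Bool
  unitPacking o = (toℕ o ℕ.<ᵇ 27) ∧ (toℕ o ℕ.% 3 ≡ᵇ 0)

data Side : Set where
  next previous : Side

unitLinks : Fin 36 → List Side
unitLinks a = if does (a ≟ # 26) then next ∷ [] else if does (a ≟ zero) then previous ∷ [] else []

NearToken : Fin 36 → Fin 36 → Set
NearToken a b = unitToken b ≡ true × (a ≡ b ⊎ Adj Unit a b)

nearToken? : ∀ a b → Dec (NearToken a b)
nearToken? a b = (unitToken b Bool.≟ true) ×-dec ((a ≟ b) ⊎-dec (unitAdj a b Bool.≟ true))

nearTokens : Fin 36 → List (Fin 36)
nearTokens a = filter (nearToken? a) (allFin 36)

opaque
  unfolding unitNeighbours unitAdj unitPosition unitHeight unitRank unitBroadcast unitPart unitToken unitTieBreak unitPacking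

  unitPosition-lipschitz : Lipschitz Unit unitPosition
  unitPosition-lipschitz {a} {b} = from-yes (all? λ a → all? λ b →
    (unitAdj a b Bool.≟ true) →-dec (unitPosition b ℕ.≤? suc (unitPosition a))) a b

  unit-dominated : ∀ o → ∃[ d ] (0 < unitBroadcast d × Reach Unit (unitBroadcast d) d o)
  unit-dominated = from-yes (all? λ o → any? λ d → (0 ℕ.<? unitBroadcast d) ×-dec reach? Unit (unitBroadcast d) d o)

  unit-parts-covered : ∀ a b → unitPart a ≡ unitPart b → ∃[ w ] (Reach Unit 1 w a × Reach Unit 1 w b)
  unit-parts-covered = from-yes (all? λ a → all? λ b →
    (unitPart a ℕ.≟ unitPart b) →-dec any? λ w → reach? Unit 1 w a ×-dec reach? Unit 1 w b)

  unit-peo : ∀ a b c → Adj Unit a b → Adj Unit a c → unitRank a < unitRank b → unitRank a < unitRank c → b ≢ c → Adj Unit b c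
  unit-peo = from-yes (all? λ a → all? λ b → all? λ c → (unitAdj a b Bool.≟ true) →-dec (unitAdj a c Bool.≟ true) →-dec
    (unitRank a ℕ.<? unitRank b) →-dec (unitRank a ℕ.<? unitRank c) →-dec ¬? (b ≟ c) →-dec (unitAdj b c Bool.≟ true))

  unitRank-injective : ∀ a b → unitRank a ≡ unitRank b → a ≡ b
  unitRank-injective = from-yes (all? λ a → all? λ b → (unitRank a ℕ.≟ unitRank b) →-dec (a ≟ b))

  unitRank<36 : ∀ a → unitRank a < 36
  unitRank<36 = from-yes (all? λ a → unitRank a ℕ.<? 36)

  unitRank-last : ∀ b → Adj Unit (# 26) b → unitRank b < unitRank (# 26)
  unitRank-last = from-yes (all? λ b → (unitAdj (# 26) b Bool.≟ true) →-dec (unitRank b ℕ.<? unitRank (# 26)))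

  unitPosition<27 : ∀ a → unitPosition a < 27
  unitPosition<27 = from-yes (all? λ a → unitPosition a ℕ.<? 27)

  unitHeight-root : ∀ a → unitHeight a ≡ 0 → a ≡ zero
  unitHeight-root = from-yes (all? λ a → (unitHeight a ℕ.≟ 0) →-dec (a ≟ zero))

  unitHeight-descent : ∀ a → a ≢ zero → ∃[ b ] (Adj Unit a b × suc (unitHeight b) ≡ unitHeight a)
  unitHeight-descent = from-yes (all? λ a →
    ¬? (a ≟ zero) →-dec any? λ b → (unitAdj a b Bool.≟ true) ×-dec (suc (unitHeight b) ℕ.≟ unitHeight a))

  unitBroadcast≤2 : ∀ a → unitBroadcast a ≤ 2
  unitBroadcast≤2 = from-yes (all? λ a → unitBroadcast a ℕ.≤? 2)

  unitPart<9 : ∀ a → unitPart a < 9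
  unitPart<9 = from-yes (all? λ a → unitPart a ℕ.<? 9)

  unitToken-slot : ∀ a → unitToken a ≡ true → tokenSlot (unitPosition a) + unitTieBreak a < tokenSlot (suc (unitPosition a))
  unitToken-slot = from-yes (all? λ a →
    (unitToken a Bool.≟ true) →-dec (tokenSlot (unitPosition a) + unitTieBreak a ℕ.<? tokenSlot (suc (unitPosition a))))

  unitToken-label-injective : ∀ a b → unitToken a ≡ true → unitToken b ≡ true →
    unitPosition a ≡ unitPosition b → unitTieBreak a ≡ unitTieBreak b → a ≡ b
  unitToken-label-injective = from-yes (all? λ a → all? λ b → (unitToken a Bool.≟ true) →-dec (unitToken b Bool.≟ true) →-dec
    (unitPosition a ℕ.≟ unitPosition b) →-dec (unitTieBreak a ℕ.≟ unitTieBreak b) →-dec (a ≟ b))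

  unitPacking-slot : ∀ a → unitPacking a ≡ true → packingSlot (unitPosition a) < packingSlot (suc (unitPosition a))
  unitPacking-slot = from-yes (all? λ a →
    (unitPacking a Bool.≟ true) →-dec (packingSlot (unitPosition a) ℕ.<? packingSlot (suc (unitPosition a))))

  unitPacking-position-injective : ∀ a b → unitPacking a ≡ true → unitPacking b ≡ true → unitPosition a ≡ unitPosition b → a ≡ b
  unitPacking-position-injective = from-yes (all? λ a → all? λ b → (unitPacking a Bool.≟ true) →-dec (unitPacking b Bool.≟ true) →-dec
    (unitPosition a ℕ.≟ unitPosition b) →-dec (a ≟ b))

  unit-radius-one : ∀ a → length (nearTokens a) + length (unitLinks a) ≤ 3
  unit-radius-one = from-yes (all? λ a → length (nearTokens a) + length (unitLinks a) ℕ.≤? 3)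

  unitPosition-first : unitPosition zero ≡ 0
  unitPosition-first = refl

  unitPosition-last : unitPosition (# 26) ≡ 26
  unitPosition-last = refl

  unitPosition-2 : unitPosition (# 2) ≡ 2
  unitPosition-2 = refl

  unitHeight-first : unitHeight zero ≡ 0
  unitHeight-first = refl

  unitHeight-last : unitHeight (# 26) ≡ 26
  unitHeight-last = refl

  unitToken-count : ∣ tabulate unitToken ∣ ≡ 30
  unitToken-count = refl

  unitPacking-count : ∣ tabulate unitPacking ∣ ≡ 9
  unitPacking-count = refl

  unitBroadcast-cost : sum unitBroadcast ≡ 10
  unitBroadcast-cost = refl

-- The graph H_k

module Construction (k : ℕ) where

  unit : Fin (k * 36) → ℕ
  unit u = toℕ (quotient {k} 36 u)

  offset : Fin (k * 36) → Fin 36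
  offset = remainder {k} 36

  vertex : (q : ℕ) → q < k → Fin 36 → Fin (k * 36)
  vertex q q<k o = combine (fromℕ< q<k) o

  unit-vertex : ∀ {q} (q<k : q < k) o → unit (vertex q q<k o) ≡ q
  unit-vertex q<k o = trans (cong (toℕ ∘ proj₁) (remQuot-combine (fromℕ< q<k) o)) (toℕ-fromℕ< q<k)

  offset-vertex : ∀ {q} (q<k : q < k) o → offset (vertex q q<k o) ≡ o
  offset-vertex q<k o = cong proj₂ (remQuot-combine (fromℕ< q<k) o)

  unit<k : ∀ u → unit u < k
  unit<k u = toℕ<n (quotient {k} 36 u)

  unit-shifted-injective : ∀ {u v} → unit u ≡ unit v → offset u ≡ offset v → u ≡ v
  unit-shifted-injective {u} {v} same-unit same-offset = begin
    u                                                            ≡⟨ combine-remQuot {k} 36 u ⟨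
    combine (quotient {k} 36 u) (offset u)                       ≡⟨ cong₂ combine (toℕ-injective same-unit) same-offset ⟩
    combine (quotient {k} 36 v) (offset v)                       ≡⟨ combine-remQuot {k} 36 v ⟩
    v                                                            ∎
    where open ≡-Reasoning

  sibling : Fin (k * 36) → Fin 36 → Fin (k * 36)
  sibling u o = combine (quotient {k} 36 u) o

  unit-sibling : ∀ u o → unit (sibling u o) ≡ unit u
  unit-sibling u o = cong (toℕ ∘ proj₁) (remQuot-combine (quotient {k} 36 u) o)

  offset-sibling : ∀ u o → offset (sibling u o) ≡ o
  offset-sibling u o = cong proj₂ (remQuot-combine (quotient {k} 36 u) o)

  sibling-offset : ∀ u → sibling u (offset u) ≡ u
  sibling-offset u = combine-remQuot {k} 36 u

  sibling-cong : ∀ {u v} o → unit u ≡ unit v → sibling u o ≡ sibling v o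
  sibling-cong o same-unit = cong (λ q → combine q o) (toℕ-injective same-unit)

  Link : Fin (k * 36) → Fin (k * 36) → Set
  Link u v = suc (unit u) ≡ unit v × offset u ≡ # 26 × offset v ≡ zero

  HAdj : Fin (k * 36) → Fin (k * 36) → Set
  HAdj u v = (unit u ≡ unit v × Adj Unit (offset u) (offset v)) ⊎ Link u v ⊎ Link v u

  HAdj? : ∀ u v → Dec (HAdj u v)
  HAdj? u v = same-unit? ⊎-dec link? u v ⊎-dec link? v u
    where
    same-unit? = (unit u ℕ.≟ unit v) ×-dec (adj Unit (offset u) (offset v) Bool.≟ true)
    link? : ∀ u v → Dec (Link u v)
    link? u v = (suc (unit u) ℕ.≟ unit v) ×-dec (offset u ≟ # 26) ×-dec (offset v ≟ zero)

  HAdj-sym : ∀ {u v} → HAdj u v → HAdj v u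
  HAdj-sym {u} {v} (inj₁ (same-unit , a)) = inj₁ (sym same-unit , Adj-sym Unit {offset u} {offset v} a)
  HAdj-sym (inj₂ (inj₁ link)) = inj₂ (inj₂ link)
  HAdj-sym (inj₂ (inj₂ link)) = inj₂ (inj₁ link)

  HAdj-irreflexive : ∀ {u} → ¬ HAdj u u
  HAdj-irreflexive {u} (inj₁ (_ , a)) = contradiction (trans (sym (irrefl Unit (offset u))) a) λ ()
  HAdj-irreflexive (inj₂ (inj₁ (e , _))) = <⇒≢ (n<1+n _) (sym e)
  HAdj-irreflexive (inj₂ (inj₂ (e , _))) = <⇒≢ (n<1+n _) (sym e)

  H : Graph
  H = record
    { n = k * 36
    ; adj = λ u v → does (HAdj? u v)
    ; sym = λ u v → does-⇔ (mk⇔ HAdj-sym HAdj-sym) (HAdj? u v) (HAdj? v u)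
    ; irrefl = λ u → dec-false (HAdj? u u) HAdj-irreflexive
    }

  HAdj⇒Adj : ∀ {u v} → HAdj u v → Adj H u v
  HAdj⇒Adj {u} {v} = dec-true (HAdj? u v)

  Adj⇒HAdj : ∀ {u v} → Adj H u v → HAdj u v
  Adj⇒HAdj {u} {v} = decided (HAdj? u v)
    where
    decided : (h? : Dec (HAdj u v)) → does h? ≡ true → HAdj u v
    decided (yes h) _ = h

  Reach-within-unit : ∀ u {r a} → Reach Unit r a (offset u) → Reach H r (sibling u a) u
  Reach-within-unit u {r} {a} a→u = subst (Reach H r _) (sibling-offset u)
    (Reach-map Unit (sibling u) embedding a→u)
    where
    embedding : ∀ {a b} → Adj Unit a b → Adj H (sibling u a) (sibling u b)
    embedding {a} {b} a~b = HAdj⇒Adj (inj₁ (trans (unit-sibling u a) (sym (unit-sibling u b)) ,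
      subst₂ (Adj Unit) (sym (offset-sibling u a)) (sym (offset-sibling u b)) a~b))

  spine-continues : ∀ q → suc q * 27 + 0 ≡ suc (q * 27 + 26)
  spine-continues q = trans (+-identityʳ (suc q * 27)) (trans (+-comm 27 (q * 27)) (+-suc (q * 27) 26))

  position : Fin (k * 36) → ℕ
  position u = unit u * 27 + unitPosition (offset u)

  position-link : ∀ {u v} → Link u v → position v ≡ suc (position u)
  position-link {u} {v} (next-unit , u-last , v-first) = begin
    unit v * 27 + unitPosition (offset v)      ≡⟨ cong₂ (λ q o → q * 27 + unitPosition o) next-unit (sym v-first) ⟨
    suc (unit u) * 27 + unitPosition zero      ≡⟨ cong (suc (unit u) * 27 +_) unitPosition-first ⟩
    suc (unit u) * 27 + 0                      ≡⟨ spine-continues (unit u) ⟩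
    suc (unit u * 27 + 26)                     ≡⟨ cong (λ o → suc (unit u * 27 + o)) (trans (cong unitPosition u-last) unitPosition-last) ⟨
    suc (position u)                           ∎
    where open ≡-Reasoning

  position-lipschitz : Lipschitz H position
  position-lipschitz {u} {v} a with Adj⇒HAdj a
  ... | inj₁ (same-unit , a′) = begin
    unit v * 27 + unitPosition (offset v)       ≡⟨ cong (λ q → q * 27 + unitPosition (offset v)) same-unit ⟨
    unit u * 27 + unitPosition (offset v)       ≤⟨ +-monoʳ-≤ (unit u * 27) (unitPosition-lipschitz a′) ⟩
    unit u * 27 + suc (unitPosition (offset u)) ≡⟨ +-suc (unit u * 27) _ ⟩
    suc (position u)                            ∎
    where open ≤-Reasoning
  ... | inj₂ (inj₁ link) = ≤-reflexive (position-link link)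
  ... | inj₂ (inj₂ link) = ≤-trans (n≤1+n (position v)) (≤-trans (≤-reflexive (sym (position-link link))) (n≤1+n (position u)))

  height : Fin (k * 36) → ℕ
  height u = unit u * 27 + unitHeight (offset u)

  connected : Connected H
  connected u v = height u + height v , Reach-++ H (to-root u) (Reach-sym H (to-root v))
    where
    0<k : 0 < k
    0<k = ≤-trans (s≤s z≤n) (unit<k u)
    root : Fin (k * 36)
    root = vertex 0 0<k zero
    height-root : ∀ {w} → height w ≡ 0 → w ≡ root
    height-root {w} h≡0 = unit-shifted-injective
      (trans (m*n≡0⇒m≡0 (unit w) 27 (m+n≡0⇒m≡0 (unit w * 27) h≡0)) (sym (unit-vertex 0<k zero)))
      (trans (unitHeight-root (offset w) (m+n≡0⇒n≡0 (unit w * 27) h≡0)) (sym (offset-vertex 0<k zero)))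
    height-descent : ∀ {w d} → height w ≡ suc d → ∃[ x ] (Adj H w x × height x ≡ d)
    height-descent {w} {d} hw = [ across-link (unit w) refl , within-unit ]′ (toSum (offset w ≟ zero))
      where
      within-unit : offset w ≢ zero → ∃[ x ] (Adj H w x × height x ≡ d)
      within-unit w≢first = x , HAdj⇒Adj (inj₁ (sym (unit-sibling w b) , w~x)) , suc-injective (begin
        suc (height x)
          ≡⟨ cong₂ (λ q o → suc (q * 27 + unitHeight o)) (unit-sibling w b) (offset-sibling w b) ⟩
        suc (unit w * 27 + unitHeight b)            ≡⟨ +-suc (unit w * 27) (unitHeight b) ⟨
        unit w * 27 + suc (unitHeight b)            ≡⟨ cong (unit w * 27 +_) b-lower ⟩
        height w                                    ≡⟨ hw ⟩
        suc d                                       ∎)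
        where
        open ≡-Reasoning
        b = proj₁ (unitHeight-descent (offset w) w≢first)
        b-lower = proj₂ (proj₂ (unitHeight-descent (offset w) w≢first))
        x = sibling w b
        w~x : Adj Unit (offset w) (offset x)
        w~x = subst (Adj Unit (offset w)) (sym (offset-sibling w b)) (proj₁ (proj₂ (unitHeight-descent (offset w) w≢first)))
      across-link : ∀ q → unit w ≡ q → offset w ≡ zero → ∃[ x ] (Adj H w x × height x ≡ d)
      across-link zero unit-w w-first = contradiction (trans (sym height≡0) hw) λ ()
        where
        height≡0 : height w ≡ 0
        height≡0 = trans (cong₂ (λ q o → q * 27 + unitHeight o) unit-w w-first) unitHeight-first
      across-link (suc q) unit-w w-first = x , HAdj⇒Adj (inj₂ (inj₂ x→w)) , suc-injective (begin
        suc (unit x * 27 + unitHeight (offset x))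
          ≡⟨ cong₂ (λ q o → suc (q * 27 + unitHeight o)) (unit-vertex q<k (# 26)) (offset-vertex q<k (# 26)) ⟩
        suc (q * 27 + unitHeight (# 26))          ≡⟨ cong (λ h → suc (q * 27 + h)) unitHeight-last ⟩
        suc (q * 27 + 26)                         ≡⟨ spine-continues q ⟨
        suc q * 27 + 0                            ≡⟨ cong₂ (λ q h → q * 27 + h) unit-w (trans (cong unitHeight w-first) unitHeight-first) ⟨
        height w                                  ≡⟨ hw ⟩
        suc d                                     ∎)
        where
        open ≡-Reasoning
        q<k : q < k
        q<k = <⇒≤ (subst (_< k) unit-w (unit<k w))
        x = vertex q q<k (# 26)
        x→w : Link x w
        x→w = trans (cong suc (unit-vertex q<k (# 26))) (sym unit-w) , offset-vertex q<k (# 26) , w-first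
    to-root : ∀ w → Reach H (height w) w root
    to-root = descent⇒Reach H height root height-root height-descent

  rank : Fin (k * 36) → ℕ
  rank u = unit u * 36 + unitRank (offset u)

  rank-injective : ∀ {u v} → rank u ≡ rank v → u ≡ v
  rank-injective {u} {v} same-rank with *+-injective 36 (unitRank<36 (offset u)) (unitRank<36 (offset v)) same-rank
  ... | same-unit , same-unitRank = unit-shifted-injective same-unit (unitRank-injective _ _ same-unitRank)

  rank-earlier-unit : ∀ {u v} → suc (unit u) ≡ unit v → rank u < rank v
  rank-earlier-unit {u} {v} next-unit = begin-strict
    unit u * 36 + unitRank (offset u)       <⟨ +-monoʳ-< (unit u * 36) (unitRank<36 (offset u)) ⟩
    unit u * 36 + 36                        ≡⟨ +-comm (unit u * 36) 36 ⟩
    suc (unit u) * 36                       ≤⟨ m≤m+n (suc (unit u) * 36) _ ⟩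
    suc (unit u) * 36 + unitRank (offset v) ≡⟨ cong (λ q → q * 36 + unitRank (offset v)) next-unit ⟩
    rank v                                  ∎
    where open ≤-Reasoning

  rank-within-unit : ∀ {u v} → unit u ≡ unit v → rank u < rank v → unitRank (offset u) < unitRank (offset v)
  rank-within-unit {u} {v} same-unit ru<rv =
    +-cancelˡ-< (unit v * 36) _ _ (subst (λ q → q * 36 + unitRank (offset u) < rank v) same-unit ru<rv)

  rank-before-link : ∀ {u w} → offset u ≡ # 26 → Adj Unit (offset u) (offset w) → unitRank (offset w) < unitRank (offset u)
  rank-before-link {u} {w} u-last u~w = subst (λ o → unitRank (offset w) < unitRank o) (sym u-last)
    (unitRank-last (offset w) (subst (λ o → Adj Unit o (offset w)) u-last u~w))

  rank-later-neighbours-adjacent : ∀ {u v w} → HAdj u v → HAdj u w → rank u < rank v → rank u < rank w → v ≢ w → HAdj v w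
  rank-later-neighbours-adjacent _ (inj₂ (inj₂ w→u)) _ ru<rw _ = contradiction (rank-earlier-unit (proj₁ w→u)) (<⇒≯ ru<rw)
  rank-later-neighbours-adjacent (inj₂ (inj₂ v→u)) _ ru<rv _ _ = contradiction (rank-earlier-unit (proj₁ v→u)) (<⇒≯ ru<rv)
  rank-later-neighbours-adjacent (inj₂ (inj₁ (uv , _ , v-first))) (inj₂ (inj₁ (uw , _ , w-first))) _ _ v≢w =
    contradiction (unit-shifted-injective (trans (sym uv) uw) (trans v-first (sym w-first))) v≢w
  rank-later-neighbours-adjacent (inj₂ (inj₁ (_ , u-last , _))) (inj₁ (uw , u~w)) _ ru<rw _ =
    contradiction (rank-within-unit uw ru<rw) (<⇒≯ (rank-before-link u-last u~w))
  rank-later-neighbours-adjacent (inj₁ (uv , u~v)) (inj₂ (inj₁ (_ , u-last , _))) ru<rv _ _ =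
    contradiction (rank-within-unit uv ru<rv) (<⇒≯ (rank-before-link u-last u~v))
  rank-later-neighbours-adjacent {u} {v} {w} (inj₁ (uv , u~v)) (inj₁ (uw , u~w)) ru<rv ru<rw v≢w =
    inj₁ (trans (sym uv) uw , unit-peo (offset u) (offset v) (offset w) u~v u~w
      (rank-within-unit uv ru<rv) (rank-within-unit uw ru<rw) (v≢w ∘ unit-shifted-injective (trans (sym uv) uw)))

  chordal : Chordal H
  chordal = peo⇒chordal record
    { rank = rank
    ; rank-injective = rank-injective
    ; later-neighbours-adjacent = λ u~v u~w ru<rv ru<rw v≢w →
        HAdj⇒Adj (rank-later-neighbours-adjacent (Adj⇒HAdj u~v) (Adj⇒HAdj u~w) ru<rv ru<rw v≢w)
    }

  position-sibling : ∀ u o → position (sibling u o) ≡ unit u * 27 + unitPosition o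
  position-sibling u o = cong₂ (λ q o → q * 27 + unitPosition o) (unit-sibling u o) (offset-sibling u o)

  same-position : ∀ {u v} → position u ≡ position v → unit u ≡ unit v × unitPosition (offset u) ≡ unitPosition (offset v)
  same-position {u} {v} = *+-injective 27 (unitPosition<27 (offset u)) (unitPosition<27 (offset v))

  broadcast : Fin (k * 36) → ℕ
  broadcast u = unitBroadcast (offset u)

  broadcast≤diam : ∀ v → LeDiam H (broadcast v)
  broadcast≤diam v = x₀ , x₂ , λ r x₀→x₂ → ≤-trans (unitBroadcast≤2 (offset v)) (two≤r r x₀→x₂)
    where
    x₀ = sibling v zero
    x₂ = sibling v (# 2)
    two≤r : ∀ r → Reach H r x₀ x₂ → 2 ≤ r
    two≤r r x₀→x₂ = +-cancelˡ-≤ (unit v * 27) 2 r (begin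
      unit v * 27 + 2                  ≡⟨ cong (unit v * 27 +_) unitPosition-2 ⟨
      unit v * 27 + unitPosition (# 2) ≡⟨ position-sibling v (# 2) ⟨
      position x₂                      ≤⟨ Reach⇒≤+ H position-lipschitz x₀→x₂ ⟩
      r + position x₀                  ≡⟨ cong (r +_) (position-sibling v zero) ⟩
      r + (unit v * 27 + unitPosition zero) ≡⟨ cong (λ p → r + (unit v * 27 + p)) unitPosition-first ⟩
      r + (unit v * 27 + 0)            ≡⟨ cong (r +_) (+-identityʳ _) ⟩
      r + unit v * 27                  ≡⟨ +-comm r (unit v * 27) ⟩
      unit v * 27 + r                  ∎)
      where open ≤-Reasoning

  broadcast-dominating : Dominating H broadcast
  broadcast-dominating u = d , subst (0 <_) βd≡ 0<β , subst (λ r → Reach H r d u) βd≡ (Reach-within-unit u d→u)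
    where
    dominator = unit-dominated (offset u)
    d = sibling u (proj₁ dominator)
    0<β = proj₁ (proj₂ dominator)
    d→u = proj₂ (proj₂ dominator)
    βd≡ : unitBroadcast (proj₁ dominator) ≡ broadcast d
    βd≡ = cong unitBroadcast (sym (offset-sibling u (proj₁ dominator)))

  broadcast-cost : cost H broadcast ≡ 10 * k
  broadcast-cost = begin
    cost H broadcast                         ≡⟨ cost≡∑ H broadcast ⟩
    sum (unitBroadcast ∘ offset)             ≡⟨ ∑-remainder k 36 unitBroadcast ⟩
    k * sum unitBroadcast                    ≡⟨ cong (k *_) unitBroadcast-cost ⟩
    k * 10                                   ≡⟨ *-comm k 10 ⟩
    10 * k                                   ∎
    where open ≡-Reasoning

  tokens : Subset (k * 36)
  tokens = tabulate (unitToken ∘ offset)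

  tokens-count : ∣ tokens ∣ ≡ 3 * (10 * k)
  tokens-count = begin
    ∣ tokens ∣                  ≡⟨ ∣tabulate∘remainder∣ k 36 unitToken ⟩
    k * ∣ tabulate unitToken ∣  ≡⟨ cong (k *_) unitToken-count ⟩
    k * 30                      ≡⟨ *-comm k 30 ⟩
    30 * k                      ≡⟨ *-assoc 3 10 k ⟩
    3 * (10 * k)                ∎
    where open ≡-Reasoning

  tieBreak : Fin (k * 36) → ℕ
  tieBreak u = unitTieBreak (offset u)

  token-slot : ∀ {u} → u ∈ tokens → tokenSlot (position u) + tieBreak u < tokenSlot (suc (position u))
  token-slot {u} u∈T = periodic-step tokenSlot 30 tokenSlot-+27 (unit u) (unitPosition (offset u)) (tieBreak u)
    (unitToken-slot (offset u) (∈-tabulate⁻ u∈T))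

  token-label-injective : ∀ {u v} → u ∈ tokens → v ∈ tokens → position u ≡ position v → tieBreak u ≡ tieBreak v → u ≡ v
  token-label-injective {u} {v} u∈T v∈T same-pos same-tie with same-position same-pos
  ... | same-unit , same-unitPosition = unit-shifted-injective same-unit
    (unitToken-label-injective _ _ (∈-tabulate⁻ u∈T) (∈-tabulate⁻ v∈T) same-unitPosition same-tie)

  linkIndex : ℕ → Side → ℕ
  linkIndex q next = suc q * 36
  linkIndex q previous = (q ∸ 1) * 36 + 26

  near-token-indices : Fin (k * 36) → List ℕ
  near-token-indices v = map (λ o → unit v * 36 + toℕ o) (nearTokens (offset v)) ++ map (linkIndex (unit v)) (unitLinks (offset v))

  toℕ-unit-offset : ∀ u → toℕ u ≡ unit u * 36 + toℕ (offset u)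
  toℕ-unit-offset u = begin
    toℕ u                                              ≡⟨ cong toℕ (combine-remQuot {k} 36 u) ⟨
    toℕ (combine (quotient {k} 36 u) (offset u))       ≡⟨ toℕ-combine (quotient {k} 36 u) (offset u) ⟩
    36 * unit u + toℕ (offset u)                       ≡⟨ cong (_+ toℕ (offset u)) (*-comm 36 (unit u)) ⟩
    unit u * 36 + toℕ (offset u)                       ∎
    where open ≡-Reasoning

  near-token-index : ∀ {v u} → u ∈ tokens → Reach H 1 v u → toℕ u ∈ˡ near-token-indices v
  near-token-index {v} {u} u∈T here = subst (_∈ˡ near-token-indices v) (sym (toℕ-unit-offset v))
    (∈-++⁺ˡ (∈-map⁺ _ (∈-filter⁺ (nearToken? (offset v)) (∈-allFin (offset v)) (∈-tabulate⁻ u∈T , inj₁ refl))))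
  near-token-index {v} {u} u∈T (step v~u here) with Adj⇒HAdj v~u
  ... | inj₁ (same-unit , v~u′) = subst (_∈ˡ near-token-indices v) index
    (∈-++⁺ˡ (∈-map⁺ _ (∈-filter⁺ (nearToken? (offset v)) (∈-allFin (offset u)) (∈-tabulate⁻ u∈T , inj₂ v~u′))))
    where
    index : unit v * 36 + toℕ (offset u) ≡ toℕ u
    index = trans (cong (λ q → q * 36 + toℕ (offset u)) same-unit) (sym (toℕ-unit-offset u))
  ... | inj₂ (inj₁ (next-unit , v-last , u-first)) = subst (_∈ˡ near-token-indices v) index
    (∈-++⁺ʳ (map _ (nearTokens (offset v)))
      (∈-map⁺ (linkIndex (unit v)) (subst (λ o → next ∈ˡ unitLinks o) (sym v-last) (here refl))))
    where
    index : suc (unit v) * 36 ≡ toℕ u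
    index = begin
      suc (unit v) * 36              ≡⟨ cong (_* 36) next-unit ⟩
      unit u * 36                    ≡⟨ +-identityʳ (unit u * 36) ⟨
      unit u * 36 + 0                ≡⟨ cong (λ o → unit u * 36 + toℕ o) u-first ⟨
      unit u * 36 + toℕ (offset u)   ≡⟨ toℕ-unit-offset u ⟨
      toℕ u                          ∎
      where open ≡-Reasoning
  ... | inj₂ (inj₂ (next-unit , u-last , v-first)) = subst (_∈ˡ near-token-indices v) index
    (∈-++⁺ʳ (map _ (nearTokens (offset v)))
      (∈-map⁺ (linkIndex (unit v)) (subst (λ o → previous ∈ˡ unitLinks o) (sym v-first) (here refl))))
    where
    index : (unit v ∸ 1) * 36 + 26 ≡ toℕ u
    index = begin
      (unit v ∸ 1) * 36 + 26         ≡⟨ cong (λ q → (q ∸ 1) * 36 + 26) next-unit ⟨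
      unit u * 36 + 26               ≡⟨ cong (λ o → unit u * 36 + toℕ o) u-last ⟨
      unit u * 36 + toℕ (offset u)   ≡⟨ toℕ-unit-offset u ⟨
      toℕ u                          ∎
      where open ≡-Reasoning

  length-near-token-indices : ∀ v → length (near-token-indices v) ≡ length (nearTokens (offset v)) + length (unitLinks (offset v))
  length-near-token-indices v = trans (length-++ (map _ (nearTokens (offset v))))
    (cong₂ _+_ (length-map _ (nearTokens (offset v))) (length-map (linkIndex (unit v)) (unitLinks (offset v))))

  tokens-radius-one : ∀ v (S : Subset (k * 36)) → S ⊆ tokens → (∀ {u} → u ∈ S → Reach H 1 v u) → ∣ S ∣ ≤ 3
  tokens-radius-one v S S⊆T S-near = begin
    ∣ S ∣                                                          ≤⟨ ∣p∣≤length S toℕ (near-token-indices v) (λ _ _ → toℕ-injective) near ⟩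
    length (near-token-indices v)                                  ≡⟨ length-near-token-indices v ⟩
    length (nearTokens (offset v)) + length (unitLinks (offset v)) ≤⟨ unit-radius-one (offset v) ⟩
    3                                                              ∎
    where
    open ≤-Reasoning
    near : ∀ {u} → u ∈ S → toℕ u ∈ˡ near-token-indices v
    near u∈S = near-token-index (S⊆T u∈S) (S-near u∈S)

  tokens-sparse : ScaledMultipacking H 3 tokens
  tokens-sparse v (suc zero) _ S S⊆T S-near = tokens-radius-one v S S⊆T S-near
  tokens-sparse v r@(suc (suc _)) _ S S⊆T S-near = ≤-trans
    (window-bound H position-lipschitz tokens tokenSlot tieBreak tokenSlot-mono token-slot token-label-injective v r S S⊆T S-near)
    (tokenSlot-window (position v) r (s≤s (s≤s z≤n)))

  broadcast-optimal : ∀ (b : Broadcast H) → Dominating H (proj₁ b) → 10 * k ≤ cost H (proj₁ b)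
  broadcast-optimal (f , _) f-dominating = *-cancelˡ-≤ {10 * k} {cost H f} 3 (begin
    3 * (10 * k) ≡⟨ tokens-count ⟨
    ∣ tokens ∣   ≤⟨ ScaledMultipacking⇒≤cost H {3} {tokens} tokens-sparse f f-dominating ⟩
    3 * cost H f ∎)
    where open ≤-Reasoning

  packing : Subset (k * 36)
  packing = tabulate (unitPacking ∘ offset)

  packing-count : ∣ packing ∣ ≡ 9 * k
  packing-count = trans (∣tabulate∘remainder∣ k 36 unitPacking) (trans (cong (k *_) unitPacking-count) (*-comm k 9))

  packing-multipacking : Multipacking H packing
  packing-multipacking v r 1≤r S S⊆M S-near = ≤-trans
    (window-bound H position-lipschitz packing packingSlot (λ _ → 0) packingSlot-mono packing-slot packing-label-injective v r S S⊆M S-near)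
    (packingSlot-window (position v) r 1≤r)
    where
    packing-slot : ∀ {u} → u ∈ packing → packingSlot (position u) + 0 < packingSlot (suc (position u))
    packing-slot {u} u∈M = periodic-step packingSlot 9 packingSlot-+27 (unit u) (unitPosition (offset u)) 0
      (subst (_< packingSlot (suc (unitPosition (offset u)))) (sym (+-identityʳ _)) (unitPacking-slot (offset u) (∈-tabulate⁻ u∈M)))
    packing-label-injective : ∀ {u w} → u ∈ packing → w ∈ packing → position u ≡ position w → 0 ≡ 0 → u ≡ w
    packing-label-injective u∈M w∈M same-pos _ with same-position same-pos
    ... | same-unit , same-unitPosition = unit-shifted-injective same-unit
      (unitPacking-position-injective _ _ (∈-tabulate⁻ u∈M) (∈-tabulate⁻ w∈M) same-unitPosition)

  part : Fin (k * 36) → ℕ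
  part u = unit u * 9 + unitPart (offset u)

  part<9k : ∀ u → part u < 9 * k
  part<9k u = begin-strict
    unit u * 9 + unitPart (offset u) <⟨ +-monoʳ-< (unit u * 9) (unitPart<9 (offset u)) ⟩
    unit u * 9 + 9                   ≡⟨ +-comm (unit u * 9) 9 ⟩
    suc (unit u) * 9                 ≤⟨ *-monoˡ-≤ 9 (unit<k u) ⟩
    k * 9                            ≡⟨ *-comm k 9 ⟩
    9 * k                            ∎
    where open ≤-Reasoning

  part-covered : ∀ {u v} → part u ≡ part v → ∃[ w ] (Reach H 1 w u × Reach H 1 w v)
  part-covered {u} {v} same-part with *+-injective 9 (unitPart<9 (offset u)) (unitPart<9 (offset v)) same-part
  ... | same-unit , same-unitPart =
    sibling u w , Reach-within-unit u w→u ,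
    subst (λ x → Reach H 1 x v) (sibling-cong w (sym same-unit)) (Reach-within-unit v w→v)
    where
    covering = unit-parts-covered (offset u) (offset v) same-unitPart
    w = proj₁ covering
    w→u = proj₁ (proj₂ covering)
    w→v = proj₂ (proj₂ covering)

  packing-optimal : ∀ M → Multipacking H M → ∣ M ∣ ≤ 9 * k
  packing-optimal M M-mp = Multipacking⇒≤ H (9 * k) part part<9k part-covered M-mp

theorem1 : ∀ (k : ℕ) → 1 ≤ k →
    Σ Graph λ H → Connected H × Chordal H ×
      MultipackingNumber H (9 * k) × BroadcastDomNumber H (10 * k)
theorem1 k _ =
  H , connected , chordal ,
  ((packing , packing-multipacking , packing-count) , packing-optimal) ,
  (((broadcast , broadcast≤diam) , broadcast-dominating , broadcast-cost) , broadcast-optimal)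
  where
  open Construction k
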